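{- Let $k\ge 1$ be an integer and let $\mathbf{w}_k=(0^k1^k)^{3k}(0^{k+1}1^{k+1})^k$. For integers $0\le i\le k$ and $0\le j\le k-1$ let $\mathbf{q}_{i,j}=1^j(0^k1^k)^{2i+j}(0^{k+1}1^{k+1})^j0^j$ and $\ell=ik+j(k+1)$. Then $\mathbf{q}_{i,j}=uv$ with $|u|=|v|$ and $P(u)=P(v)=(\ell,\ell)$ (so $\mathbf{q}_{i,j}$ is an Abelian square), and $\mathbf{q}_{i,j}$ occurs in $\mathbf{w}_k$ starting at position $6k^2-4ik-(2k+1)j+1$ (positions numbered from $1$).
   Context: For a binary word $x$, $P(x)=(|x|_0,|x|_1)$ where $|x|_c$ is the number of occurrences of the letter $c$ in $x$. An Abelian square is a word $uv$ with $u,v$ nonempty, $|u|=|v|$ and $P(u)=P(v)$. Exponents denote repetition of words. -}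

module Defs where

open import Data.Nat using (ℕ; zero; suc; _+_; _*_)
open import Data.List using (List; []; _∷_; _++_; replicate; length)
open import Data.Product using (_×_; _,_)

data Bit : Set where
  b0 b1 : Bit

Word : Set
Word = List Bit

_^ʷ_ : Word → ℕ → Word
x ^ʷ zero  = []
x ^ʷ suc n = x ++ (x ^ʷ n)

_^ᶜ_ : Bit → ℕ → Word
c ^ᶜ n = replicate n c

count : Bit → Word → ℕ
count c [] = 0
count b0 (b0 ∷ x) = suc (count b0 x)
count b0 (b1 ∷ x) = count b0 x
count b1 (b0 ∷ x) = count b1 x
count b1 (b1 ∷ x) = suc (count b1 x)

P : Word → ℕ × ℕ
P x = count b0 x , count b1 x

block : ℕ → Word
block m = (b0 ^ᶜ m) ++ (b1 ^ᶜ m)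

w : ℕ → Word
w k = (block k ^ʷ (3 * k)) ++ (block (suc k) ^ʷ k)

q : ℕ → ℕ → ℕ → Word
q k i j = (b1 ^ᶜ j) ++ ((block k ^ʷ (2 * i + j)) ++ ((block (suc k) ^ʷ j) ++ (b0 ^ᶜ j)))

module Submission where

open import Defs
open import Data.Nat using (ℕ; zero; suc; _+_; _*_; _≤_; _<_)
open import Data.Nat.Properties using (+-comm; +-suc; +-mono-≤; *-monoʳ-≤; m≤n⇒∃[o]m+o≡n; module ≤-Reasoning)
open import Data.Nat.Tactic.RingSolver using (solve-∀)
open import Data.List using ([]; _∷_; _++_; length; replicate)
open import Data.List.Properties using (++-assoc; ++-identityʳ; ++-monoid; length-++; length-replicate)
open import Data.Product using (_×_; _,_; ∃-syntax)
open import Relation.Binary.PropositionalEquality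
open import Tactic.MonoidSolver using (solve)

-- Write k = j + m with m ≥ 1, A = 0^j, C = 0^m 1^k and C′ = 0^(m+1) 1^(k+1), so that
-- 0^k 1^k = A C and 0^(k+1) 1^(k+1) = A C′.  Sliding A through the powers gives
-- q_{i,j} = 1^j (AC)^(i+j) A · (CA)^i (C′A)^j, and each half is a rotation of a
-- concatenation of words 0^n 1^n, hence has as many zeros as ones; counting them gives ℓ.
-- As 2i + j < 3k, q_{i,j} begins inside the (3k − 2i − j)-th factor 0^k 1^k of w_k,
-- right after its prefix 0^k 1^m, and ends right after the prefix A of the
-- (j + 1)-th factor 0^(k+1) 1^(k+1).

replicate-+ : ∀ {A : Set} m n (c : A) → replicate (m + n) c ≡ replicate m c ++ replicate n c
replicate-+ zero    n c = refl
replicate-+ (suc m) n c = cong (c ∷_) (replicate-+ m n c)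

^ʷ-+ : ∀ (x : Word) m n → x ^ʷ (m + n) ≡ x ^ʷ m ++ x ^ʷ n
^ʷ-+ x zero    n = refl
^ʷ-+ x (suc m) n = trans (cong (x ++_) (^ʷ-+ x m n)) (sym (++-assoc x (x ^ʷ m) (x ^ʷ n)))

^ʷ-slide : ∀ (a c : Word) n → (a ++ c) ^ʷ n ++ a ≡ a ++ (c ++ a) ^ʷ n
^ʷ-slide a c zero    = sym (++-identityʳ a)
^ʷ-slide a c (suc n) = begin
  ((a ++ c) ++ (a ++ c) ^ʷ n) ++ a    ≡⟨ ++-assoc (a ++ c) _ a ⟩
  (a ++ c) ++ ((a ++ c) ^ʷ n ++ a)    ≡⟨ cong ((a ++ c) ++_) (^ʷ-slide a c n) ⟩
  (a ++ c) ++ (a ++ (c ++ a) ^ʷ n)    ≡⟨ solve (++-monoid Bit) ⟩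
  a ++ ((c ++ a) ++ (c ++ a) ^ʷ n)    ∎
  where open ≡-Reasoning

length-^ʷ : ∀ (x : Word) n → length (x ^ʷ n) ≡ n * length x
length-^ʷ x zero    = refl
length-^ʷ x (suc n) = trans (length-++ x) (cong (length x +_) (length-^ʷ x n))

0^[j+m]-prefix : ∀ j m n → b0 ^ᶜ (j + m) ++ b1 ^ᶜ n ≡ b0 ^ᶜ j ++ (b0 ^ᶜ m ++ b1 ^ᶜ n)
0^[j+m]-prefix j m n = trans (cong (_++ b1 ^ᶜ n) (replicate-+ j m b0)) (++-assoc (b0 ^ᶜ j) _ _)

count-++ : ∀ c (x y : Word) → count c (x ++ y) ≡ count c x + count c y
count-++ c  []       y = refl
count-++ b0 (b0 ∷ x) y = cong suc (count-++ b0 x y)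
count-++ b0 (b1 ∷ x) y = count-++ b0 x y
count-++ b1 (b0 ∷ x) y = count-++ b1 x y
count-++ b1 (b1 ∷ x) y = cong suc (count-++ b1 x y)

count-^ʷ : ∀ c (x : Word) n → count c (x ^ʷ n) ≡ n * count c x
count-^ʷ c x zero    = refl
count-^ʷ c x (suc n) = trans (count-++ c x (x ^ʷ n)) (cong (count c x +_) (count-^ʷ c x n))

count-block : ∀ c n → count c (block n) ≡ n
count-block c n = trans (count-++ c (b0 ^ᶜ n) (b1 ^ᶜ n)) (count-0ⁿ+count-1ⁿ c n)
  where
  count-0ⁿ+count-1ⁿ : ∀ c n → count c (b0 ^ᶜ n) + count c (b1 ^ᶜ n) ≡ n
  count-0ⁿ+count-1ⁿ c  zero    = refl
  count-0ⁿ+count-1ⁿ b0 (suc n) = cong suc (count-0ⁿ+count-1ⁿ b0 n)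
  count-0ⁿ+count-1ⁿ b1 (suc n) = trans (+-suc _ _) (cong suc (count-0ⁿ+count-1ⁿ b1 n))

length≡count₀+count₁ : ∀ (x : Word) → length x ≡ count b0 x + count b1 x
length≡count₀+count₁ []       = refl
length≡count₀+count₁ (b0 ∷ x) = cong suc (length≡count₀+count₁ x)
length≡count₀+count₁ (b1 ∷ x) = trans (cong suc (length≡count₀+count₁ x)) (sym (+-suc _ _))

record Balanced (n : ℕ) (x : Word) : Set where
  constructor balanced
  field count≡ : ∀ c → count c x ≡ n
open Balanced

block-balanced : ∀ n → Balanced n (block n)
block-balanced n = balanced λ c → count-block c n

++-balanced : ∀ {m n x y} → Balanced m x → Balanced n y → Balanced (m + n) (x ++ y)
++-balanced {x = x} {y} bx by = balanced λ c → trans (count-++ c x y) (cong₂ _+_ (count≡ bx c) (count≡ by c))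

^ʷ-balanced : ∀ {m x} n → Balanced m x → Balanced (n * m) (x ^ʷ n)
^ʷ-balanced {x = x} n bx = balanced λ c → trans (count-^ʷ c x n) (cong (n *_) (count≡ bx c))

balanced-rotate : ∀ {n} x y → Balanced n (x ++ y) → Balanced n (y ++ x)
balanced-rotate {n} x y bxy = balanced λ c → begin
  count c (y ++ x)           ≡⟨ count-++ c y x ⟩
  count c y + count c x      ≡⟨ +-comm (count c y) (count c x) ⟩
  count c x + count c y      ≡⟨ sym (count-++ c x y) ⟩
  count c (x ++ y)           ≡⟨ count≡ bxy c ⟩
  n                          ∎
  where open ≡-Reasoning

balanced-P : ∀ {n x} → Balanced n x → P x ≡ (n , n)
balanced-P bx = cong₂ _,_ (count≡ bx b0) (count≡ bx b1)

balanced-length : ∀ {n x} → Balanced n x → length x ≡ n + n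
balanced-length {x = x} bx = trans (length≡count₀+count₁ x) (cong₂ _+_ (count≡ bx b0) (count≡ bx b1))

module AbelianSquare (i j m : ℕ) where

  k ℓ : ℕ
  k = j + m
  ℓ = i * k + j * suc k

  A C C′ u v : Word
  A  = b0 ^ᶜ j
  C  = b0 ^ᶜ m ++ b1 ^ᶜ k
  C′ = b0 ^ᶜ suc m ++ b1 ^ᶜ suc k
  u  = b1 ^ᶜ j ++ (block k ^ʷ (i + j) ++ A)
  v  = (C ++ A) ^ʷ i ++ (C′ ++ A) ^ʷ j

  block≡AC : block k ≡ A ++ C
  block≡AC = 0^[j+m]-prefix j m k

  block≡AC′ : block (suc k) ≡ A ++ C′
  block≡AC′ = trans (cong (λ n → b0 ^ᶜ n ++ b1 ^ᶜ suc k) (sym (+-suc j m)))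
                    (0^[j+m]-prefix j (suc m) (suc k))

  q≡uv : q k i j ≡ u ++ v
  q≡uv = begin
    b1 ^ᶜ j ++ (block k ^ʷ (2 * i + j) ++ (block (suc k) ^ʷ j ++ A))
      ≡⟨ cong (λ n → b1 ^ᶜ j ++ (block k ^ʷ n ++ (block (suc k) ^ʷ j ++ A))) (2i+j≡[i+j]+i i j) ⟩
    b1 ^ᶜ j ++ (block k ^ʷ ((i + j) + i) ++ (block (suc k) ^ʷ j ++ A))
      ≡⟨ cong (λ z → b1 ^ᶜ j ++ (z ++ (block (suc k) ^ʷ j ++ A))) (^ʷ-+ (block k) (i + j) i) ⟩
    b1 ^ᶜ j ++ ((block k ^ʷ (i + j) ++ block k ^ʷ i) ++ (block (suc k) ^ʷ j ++ A))
      ≡⟨ cong₂ (λ B B′ → b1 ^ᶜ j ++ ((block k ^ʷ (i + j) ++ B ^ʷ i) ++ (B′ ^ʷ j ++ A)))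
               block≡AC block≡AC′ ⟩
    b1 ^ᶜ j ++ ((block k ^ʷ (i + j) ++ (A ++ C) ^ʷ i) ++ ((A ++ C′) ^ʷ j ++ A))
      ≡⟨ cong (λ z → b1 ^ᶜ j ++ ((block k ^ʷ (i + j) ++ (A ++ C) ^ʷ i) ++ z)) (^ʷ-slide A C′ j) ⟩
    b1 ^ᶜ j ++ ((block k ^ʷ (i + j) ++ (A ++ C) ^ʷ i) ++ (A ++ (C′ ++ A) ^ʷ j))
      ≡⟨ solve (++-monoid Bit) ⟩
    b1 ^ᶜ j ++ (block k ^ʷ (i + j) ++ (((A ++ C) ^ʷ i ++ A) ++ (C′ ++ A) ^ʷ j))
      ≡⟨ cong (λ z → b1 ^ᶜ j ++ (block k ^ʷ (i + j) ++ (z ++ (C′ ++ A) ^ʷ j))) (^ʷ-slide A C i) ⟩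
    b1 ^ᶜ j ++ (block k ^ʷ (i + j) ++ ((A ++ (C ++ A) ^ʷ i) ++ (C′ ++ A) ^ʷ j))
      ≡⟨ solve (++-monoid Bit) ⟩
    u ++ v ∎
    where
    open ≡-Reasoning
    2i+j≡[i+j]+i : ∀ i j → 2 * i + j ≡ (i + j) + i
    2i+j≡[i+j]+i = solve-∀

  u-balanced : Balanced ℓ u
  u-balanced = subst (λ n → Balanced n u) ([i+j]k+j≡ℓ i j k)
    (balanced-rotate (block k ^ʷ (i + j) ++ A) (b1 ^ᶜ j)
      (subst (Balanced _) (sym (++-assoc (block k ^ʷ (i + j)) A (b1 ^ᶜ j)))
        (++-balanced (^ʷ-balanced (i + j) (block-balanced k)) (block-balanced j))))
    where
    [i+j]k+j≡ℓ : ∀ i j k → (i + j) * k + j ≡ i * k + j * suc k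
    [i+j]k+j≡ℓ = solve-∀

  v-balanced : Balanced ℓ v
  v-balanced = ++-balanced (^ʷ-balanced i (rotated-block A C block≡AC))
                           (^ʷ-balanced j (rotated-block A C′ block≡AC′))
    where
    rotated-block : ∀ {n} (a c : Word) → block n ≡ a ++ c → Balanced n (c ++ a)
    rotated-block {n} a c eq = balanced-rotate a c (subst (Balanced n) eq (block-balanced n))

  q-abelian-square : ∃[ u ] ∃[ v ] (q k i j ≡ u ++ v × length u ≡ length v
                                      × P u ≡ (ℓ , ℓ) × P v ≡ (ℓ , ℓ))
  q-abelian-square =
    u , v , q≡uv
    , trans (balanced-length u-balanced) (sym (balanced-length v-balanced))
    , balanced-P u-balanced , balanced-P v-balanced

module Occurrence (i j d a : ℕ) (3k≡ : suc (2 * i + j) + a ≡ 3 * (j + suc d)) where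

  open AbelianSquare i j (suc d) using (k; A; C′; block≡AC′)

  x y : Word
  x = block k ^ʷ a ++ (b0 ^ᶜ k ++ b1 ^ᶜ suc d)
  y = C′ ++ block (suc k) ^ʷ d

  block≡0ᵏ1ᵐ1ʲ : block k ≡ b0 ^ᶜ k ++ (b1 ^ᶜ suc d ++ b1 ^ᶜ j)
  block≡0ᵏ1ᵐ1ʲ = cong (b0 ^ᶜ k ++_) (trans (cong (b1 ^ᶜ_) (+-comm j (suc d))) (replicate-+ (suc d) j b1))

  w≡xqy : w k ≡ x ++ (q k i j ++ y)
  w≡xqy = begin
    block k ^ʷ (3 * k) ++ block (suc k) ^ʷ k
      ≡⟨ cong (λ n → block k ^ʷ n ++ block (suc k) ^ʷ k) (trans (sym 3k≡) (+-comm (suc (2 * i + j)) a)) ⟩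
    block k ^ʷ (a + suc (2 * i + j)) ++ block (suc k) ^ʷ (j + suc d)
      ≡⟨ cong₂ _++_ (^ʷ-+ (block k) a (suc (2 * i + j))) (^ʷ-+ (block (suc k)) j (suc d)) ⟩
    (block k ^ʷ a ++ (block k ++ block k ^ʷ (2 * i + j)))
      ++ (block (suc k) ^ʷ j ++ (block (suc k) ++ block (suc k) ^ʷ d))
      ≡⟨ cong₂ (λ B B′ → (block k ^ʷ a ++ (B ++ block k ^ʷ (2 * i + j)))
                          ++ (block (suc k) ^ʷ j ++ (B′ ++ block (suc k) ^ʷ d)))
               block≡0ᵏ1ᵐ1ʲ block≡AC′ ⟩
    (block k ^ʷ a ++ ((b0 ^ᶜ k ++ (b1 ^ᶜ suc d ++ b1 ^ᶜ j)) ++ block k ^ʷ (2 * i + j)))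
      ++ (block (suc k) ^ʷ j ++ ((A ++ C′) ++ block (suc k) ^ʷ d))
      ≡⟨ regroup (block k ^ʷ a) (b0 ^ᶜ k) (b1 ^ᶜ suc d) (b1 ^ᶜ j) (block k ^ʷ (2 * i + j))
                 (block (suc k) ^ʷ j) A C′ (block (suc k) ^ʷ d) ⟩
    x ++ ((b1 ^ᶜ j ++ (block k ^ʷ (2 * i + j) ++ (block (suc k) ^ʷ j ++ A))) ++ y) ∎
    where
    open ≡-Reasoning
    regroup : ∀ (X₁ X₂ X₃ Q₁ Q₂ Q₃ Q₄ Y₁ Y₂ : Word) →
      (X₁ ++ ((X₂ ++ (X₃ ++ Q₁)) ++ Q₂)) ++ (Q₃ ++ ((Q₄ ++ Y₁) ++ Y₂))
        ≡ (X₁ ++ (X₂ ++ X₃)) ++ ((Q₁ ++ (Q₂ ++ (Q₃ ++ Q₄))) ++ (Y₁ ++ Y₂))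
    regroup _ _ _ _ _ _ _ _ _ = solve (++-monoid Bit)

  x-position : suc (length x) + 4 * i * k + (2 * k + 1) * j ≡ 6 * k * k + 1
  x-position = begin
    suc (length x) + 4 * i * k + (2 * k + 1) * j
      ≡⟨ cong (λ n → suc n + 4 * i * k + (2 * k + 1) * j) length-x ⟩
    suc (a * (k + k) + (k + suc d)) + 4 * i * k + (2 * k + 1) * j
      ≡⟨ in-block-units a i j d ⟩
    suc ((suc (2 * i + j) + a) * (k + k))
      ≡⟨ cong (λ n → suc (n * (k + k))) 3k≡ ⟩
    suc (3 * k * (k + k))
      ≡⟨ 3k[k+k]≡6kk k ⟩
    6 * k * k + 1 ∎
    where
    open ≡-Reasoning
    length-x : length x ≡ a * (k + k) + (k + suc d)
    length-x = trans (length-++ (block k ^ʷ a))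
      (cong₂ _+_ (trans (length-^ʷ (block k) a) (cong (a *_) (balanced-length (block-balanced k))))
                 (trans (length-++ (b0 ^ᶜ k)) (cong₂ _+_ (length-replicate k) (length-replicate (suc d)))))
    in-block-units : ∀ a i j d →
      let k = j + suc d in
      suc (a * (k + k) + (k + suc d)) + 4 * i * k + (2 * k + 1) * j ≡ suc ((suc (2 * i + j) + a) * (k + k))
    in-block-units = solve-∀
    3k[k+k]≡6kk : ∀ k → suc (3 * k * (k + k)) ≡ 6 * k * k + 1
    3k[k+k]≡6kk = solve-∀

  q-occurs : ∃[ x ] ∃[ y ] (w k ≡ x ++ (q k i j ++ y)
                             × suc (length x) + 4 * i * k + (2 * k + 1) * j ≡ 6 * k * k + 1)
  q-occurs = x , y , w≡xqy , x-position

<⇒∃-+suc : ∀ {j k} → j < k → ∃[ d ] (j + suc d ≡ k)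
<⇒∃-+suc {j} j<k with m≤n⇒∃[o]m+o≡n j<k
... | d , eq = d , trans (+-suc j d) eq

2i+j<3k : ∀ {i j k} → i ≤ k → j < k → suc (2 * i + j) ≤ 3 * k
2i+j<3k {i} {j} {k} i≤k j<k = begin
  suc (2 * i + j)  ≡⟨ sym (+-suc (2 * i) j) ⟩
  2 * i + suc j    ≤⟨ +-mono-≤ (*-monoʳ-≤ 2 i≤k) j<k ⟩
  2 * k + k        ≡⟨ +-comm (2 * k) k ⟩
  3 * k            ∎
  where open ≤-Reasoning

lemma6 : (k i j : ℕ) → 1 ≤ k → i ≤ k → j < k →
    (∃[ u ] ∃[ v ] (q k i j ≡ u ++ v × length u ≡ length v
       × P u ≡ (i * k + j * suc k , i * k + j * suc k)
       × P v ≡ (i * k + j * suc k , i * k + j * suc k)))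
    × (∃[ x ] ∃[ y ] (w k ≡ x ++ (q k i j ++ y)
       × suc (length x) + 4 * i * k + (2 * k + 1) * j ≡ 6 * k * k + 1))
lemma6 k i j _ i≤k j<k with <⇒∃-+suc j<k | m≤n⇒∃[o]m+o≡n (2i+j<3k i≤k j<k)
... | d , refl | a , 3k≡ = AbelianSquare.q-abelian-square i j (suc d) , Occurrence.q-occurs i j d a 3k≡
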